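{- Let $M$ be a square $\{0,1\}$-matrix with exactly $k$ diagonal entries equal to $0$ and exactly $\ell$ diagonal entries equal to $1$, and let $D$ be a minimal $M$-obstruction. If $S$ is a homogeneous strong clique of $D$, then $|S|\le k+1$. Similarly, if $S$ is a homogeneous independent set of $D$, then $|S|\le \ell+1$.
   Context: Digraphs are finite, without loops and multiple arcs. A strong clique: set $C$ with both $(x,y),(y,x)$ arcs for all distinct $x,y\in C$; an independent set: set with no arcs between any two of its vertices. For disjoint $S,S'$, $S$ is completely adjacent (resp. completely non-adjacent) to $S'$ if $(x,x')$ is an arc for all (resp. no) $x\in S,x'\in S'$. An $M$-partition of $D$ ($M$ of size $k+\ell$) is a partition of $V(D)$ into possibly empty parts $V_1,\dots,V_{k+\ell}$ with $V_i$ independent if $M(i,i)=0$, a strong clique if $M(i,i)=1$, and for $i\ne j$, $V_i$ completely non-adjacent to $V_j$ if $M(i,j)=0$ and completely adjacent to $V_j$ if $M(i,j)=1$. A minimal $M$-obstruction is a digraph with no $M$-partition such that $D-v$ has an $M$-partition for every vertex $v$. For distinct vertices $u,v,w$, $w$ distinguishes $u,v$ if exactly one of $u,v$ is an in-neighbour of $w$ or exactly one is an out-neighbour of $w$; distinct $u,v$ are twins if no vertex distinguishes them. A homogeneous set is a set of vertices any two distinct members of which are twins in $D$; a homogeneous strong clique (resp. homogeneous independent set) is a homogeneous set that is a strong clique (resp. independent set). -}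

module Defs where

open import Data.Nat using (ℕ)
open import Data.Bool using (Bool; true; false)
open import Data.Fin using (Fin)
open import Data.Fin.Subset using (Subset; _∈_; _∉_; ∣_∣)
open import Data.Vec using (Vec; tabulate; count)
open import Data.Product using (Σ; _×_)
open import Relation.Binary.PropositionalEquality using (_≡_; _≢_)
open import Relation.Nullary using (¬_)
open import Data.Bool.Properties using (T?)
open import Data.Bool using (T; not)
open import Data.Fin using (_≟_)
open import Relation.Nullary using (does)
open import Data.Sum using (_⊎_)

record Digraph (n : ℕ) : Set where
  field
    arc     : Fin n → Fin n → Bool
    noLoops : ∀ x → arc x x ≡ false
open Digraph public

-- A square {0,1}-matrix of size m (false = 0, true = 1).
Matrix : ℕ → Set
Matrix m = Fin m → Fin m → Bool

numDiagZero : ∀ {m} → Matrix m → ℕ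
numDiagZero {m} M = count (λ i → T? (not (M i i))) (tabulate {n = m} (λ i → i))

numDiagOne : ∀ {m} → Matrix m → ℕ
numDiagOne {m} M = count (λ i → T? (M i i)) (tabulate {n = m} (λ i → i))

-- An M-partition of the induced subdigraph D[U] (parts V_i = p⁻¹(i) ∩ U,
-- possibly empty).  For distinct x, y ∈ U:
--  * same part i: V_i strong clique if M i i = 1 (arc), independent if 0 (no arc);
--  * parts i ≠ j: completely adjacent if M i j = 1, completely non-adjacent if 0.
-- In all cases this says exactly: arc x y ≡ M (p x) (p y).
IsMPartitionOn : ∀ {n m} → Matrix m → Digraph n → Subset n → (Fin n → Fin m) → Set
IsMPartitionOn M D U p =
  ∀ x y → x ∈ U → y ∈ U → x ≢ y → arc D x y ≡ M (p x) (p y)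

HasMPartitionOn : ∀ {n m} → Matrix m → Digraph n → Subset n → Set
HasMPartitionOn {n} {m} M D U = Σ (Fin n → Fin m) (IsMPartitionOn M D U)

allV : ∀ {n} → Subset n
allV = tabulate (λ _ → true)

allBut : ∀ {n} → Fin n → Subset n
allBut v = tabulate (λ x → not (does (x ≟ v)))

MinimalObstruction : ∀ {n m} → Matrix m → Digraph n → Set
MinimalObstruction M D =
  ¬ HasMPartitionOn M D allV × (∀ v → HasMPartitionOn M D (allBut v))

Distinguishes : ∀ {n} → Digraph n → Fin n → Fin n → Fin n → Set
Distinguishes D w u v = (arc D u w ≢ arc D v w) ⊎ (arc D w u ≢ arc D w v)

Twins : ∀ {n} → Digraph n → Fin n → Fin n → Set
Twins D u v = u ≢ v × (∀ w → w ≢ u → w ≢ v → ¬ Distinguishes D w u v)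

Homogeneous : ∀ {n} → Digraph n → Subset n → Set
Homogeneous D S = ∀ u v → u ∈ S → v ∈ S → u ≢ v → Twins D u v

StrongClique : ∀ {n} → Digraph n → Subset n → Set
StrongClique D S = ∀ x y → x ∈ S → y ∈ S → x ≢ y → arc D x y ≡ true

Independent : ∀ {n} → Digraph n → Subset n → Set
Independent D S = ∀ x y → x ∈ S → y ∈ S → x ≢ y → arc D x y ≡ false

module Submission where

-- Both halves of the theorem are one statement about a Boolean b: if every
-- arc value inside a homogeneous set S equals b, then |S| ≤ 1 + #{i : M i i ≠ b}
-- (b = 1 gives cliques and k, b = 0 independent sets and ℓ).
--
-- Delete any v ∈ S; by minimality D - v has an M-partition p.
--  * Twin extension: if some u ∈ S - v lies in a part i with M i i = b, then
--    sending v to the part of its twin u is an M-partition of all of D,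
--    which is impossible.  So every u ∈ S - v lies in a part i with M i i ≠ b.
--  * Two distinct vertices of S - v cannot share a part i: their arc is b,
--    while the partition forces it to be M i i ≠ b.
-- Hence p injects S - v into {i : M i i ≠ b}, so |S - v| ≤ #{i : M i i ≠ b},
-- and |S| ≤ 1 + |S - v|.

open import Defs
open import Data.Nat using (ℕ; zero; suc; _≤_; z≤n; s≤s)
open import Data.Nat.Properties using (≤-reflexive; ≤-trans; m≤n⇒m≤1+n)
open import Data.Bool using (Bool; true; false; not; _xor_; if_then_else_)
open import Data.Bool.Properties using (T?) renaming (_≟_ to _≟ᵇ_)
open import Data.Fin using (Fin; zero; suc; _≟_)
open import Data.Fin.Properties using (suc-injective; 0≢1+n)
open import Data.Fin.Subset using (Subset; ∣_∣; _∈_; _∉_; _-_; inside; outside)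
open import Data.Fin.Subset.Properties
  using (x∈p∧x≢y⇒x∈p-y; x∈p⇒∣p-x∣<∣p∣; p─q⊆p; p─⊥≡p; nonempty?; Empty-unique; ∣⊥∣≡0)
open import Data.Vec using ([]; _∷_; tabulate; count)
open import Data.Vec.Properties using (lookup⇒[]=; lookup∘tabulate)
open import Data.Vec.Base using (here; there)
open import Data.Product using (_×_; _,_; proj₁)
open import Data.Sum using (inj₁; inj₂)
open import Data.Empty using (⊥-elim)
open import Function using (id; _∘_)
open import Relation.Binary.PropositionalEquality
open import Relation.Nullary using (yes; no; does)
open import Relation.Nullary.Decidable using (dec-false; decidable-stable)

∈-tabulate : ∀ {n} (g : Fin n → Bool) {x : Fin n} → g x ≡ true → x ∈ tabulate g
∈-tabulate g {x} gx = lookup⇒[]= x (tabulate g) (trans (lookup∘tabulate g x) gx)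

∈-allBut : ∀ {n} {v x : Fin n} → x ≢ v → x ∈ allBut v
∈-allBut {v = v} {x} x≢v = ∈-tabulate _ (cong not (dec-false (x ≟ v) x≢v))

x∉p-x : ∀ {n} (p : Subset n) (x : Fin n) → x ∉ p - x
x∉p-x (b ∷ p) zero    ()
x∉p-x (b ∷ p) (suc x) (there x∈) = x∉p-x p x x∈

∈p-y⇒≢y : ∀ {n} (p : Subset n) {x y : Fin n} → x ∈ p - y → x ≢ y
∈p-y⇒≢y p {x} x∈ refl = x∉p-x p x x∈

∣p∣≤1+∣p-x∣ : ∀ {n} (p : Subset n) (x : Fin n) → ∣ p ∣ ≤ suc ∣ p - x ∣
∣p∣≤1+∣p-x∣ (inside  ∷ p) zero    = s≤s (≤-reflexive (cong ∣_∣ (sym (p─⊥≡p p))))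
∣p∣≤1+∣p-x∣ (outside ∷ p) zero    = m≤n⇒m≤1+n (≤-reflexive (cong ∣_∣ (sym (p─⊥≡p p))))
∣p∣≤1+∣p-x∣ (inside  ∷ p) (suc x) = s≤s (∣p∣≤1+∣p-x∣ p x)
∣p∣≤1+∣p-x∣ (outside ∷ p) (suc x) = ∣p∣≤1+∣p-x∣ p x

bound-by-deletions : ∀ {n} (S : Subset n) (k : ℕ) →
  (∀ v → v ∈ S → ∣ S - v ∣ ≤ k) → ∣ S ∣ ≤ suc k
bound-by-deletions {n} S k bound with nonempty? S
... | yes (v , v∈S) = ≤-trans (∣p∣≤1+∣p-x∣ S v) (s≤s (bound v v∈S))
... | no empty rewrite Empty-unique empty | ∣⊥∣≡0 n = z≤n

injection-size : ∀ {n m} (S : Subset n) (T : Subset m) (f : Fin n → Fin m) →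
  (∀ x → x ∈ S → f x ∈ T) →
  (∀ x y → x ∈ S → y ∈ S → f x ≡ f y → x ≡ y) → ∣ S ∣ ≤ ∣ T ∣
injection-size []            T f into injective = z≤n
injection-size (outside ∷ S) T f into injective =
  injection-size S T (f ∘ suc) (λ x x∈ → into (suc x) (there x∈))
    (λ x y x∈ y∈ e → suc-injective (injective (suc x) (suc y) (there x∈) (there y∈) e))
injection-size (inside ∷ S)  T f into injective =
  ≤-trans (s≤s rest) (x∈p⇒∣p-x∣<∣p∣ (into zero here))
  where
  rest : ∣ S ∣ ≤ ∣ T - f zero ∣
  rest = injection-size S (T - f zero) (f ∘ suc)
    (λ x x∈ → x∈p∧x≢y⇒x∈p-y (into (suc x) (there x∈))
      (λ e → 0≢1+n (sym (injective (suc x) zero (there x∈) here e))))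
    (λ x y x∈ y∈ e → suc-injective (injective (suc x) (suc y) (there x∈) (there y∈) e))

∣tabulate∣≡count : ∀ {n N} (h : Fin n → Fin N) (g : Fin N → Bool) →
  ∣ tabulate (g ∘ h) ∣ ≡ count (T? ∘ g) (tabulate h)
∣tabulate∣≡count {zero}  h g = refl
∣tabulate∣≡count {suc n} h g with g (h zero)
... | true  = cong suc (∣tabulate∣≡count (h ∘ suc) g)
... | false = ∣tabulate∣≡count (h ∘ suc) g

twin-in : ∀ {n} (D : Digraph n) {u v : Fin n} → Twins D u v →
  ∀ w → w ≢ u → w ≢ v → arc D u w ≡ arc D v w
twin-in D {u} {v} (_ , twins) w w≢u w≢v =
  decidable-stable (arc D u w ≟ᵇ arc D v w) (λ differ → twins w w≢u w≢v (inj₁ differ))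

twin-out : ∀ {n} (D : Digraph n) {u v : Fin n} → Twins D u v →
  ∀ w → w ≢ u → w ≢ v → arc D w u ≡ arc D w v
twin-out D {u} {v} (_ , twins) w w≢u w≢v =
  decidable-stable (arc D w u ≟ᵇ arc D w v) (λ differ → twins w w≢u w≢v (inj₂ differ))

merge : ∀ {n} → Fin n → Fin n → Fin n → Fin n
merge v u x = if does (x ≟ v) then u else x

module TwinExtension {n m} (M : Matrix m) (D : Digraph n) {u v : Fin n}
  (twins : Twins D u v) (p : Fin n → Fin m) (part : IsMPartitionOn M D (allBut v) p)
  where

  private
    u≢v : u ≢ v
    u≢v = proj₁ twins

  from-v : arc D v u ≡ M (p u) (p u) → ∀ y → y ≢ v → arc D v y ≡ M (p u) (p y)
  from-v vu y y≢v with y ≟ u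
  ... | yes refl = vu
  ... | no  y≢u  = trans (sym (twin-in D twins y y≢u y≢v))
                         (part u y (∈-allBut u≢v) (∈-allBut y≢v) (≢-sym y≢u))

  to-v : arc D u v ≡ M (p u) (p u) → ∀ x → x ≢ v → arc D x v ≡ M (p x) (p u)
  to-v uv x x≢v with x ≟ u
  ... | yes refl = uv
  ... | no  x≢u  = trans (sym (twin-out D twins x x≢u x≢v))
                         (part x u (∈-allBut x≢v) (∈-allBut u≢v) x≢u)

  -- splitting on x ≟ v and y ≟ v also evaluates `merge v u` at x and y
  extend : arc D u v ≡ M (p u) (p u) → arc D v u ≡ M (p u) (p u) →
    IsMPartitionOn M D allV (p ∘ merge v u)
  extend uv vu x y _ _ x≢y with x ≟ v | y ≟ v
  ... | yes refl | yes refl = ⊥-elim (x≢y refl)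
  ... | yes refl | no y≢v = from-v vu y y≢v
  ... | no x≢v | yes refl = to-v uv x x≢v
  ... | no x≢v | no y≢v =
    part x y (∈-allBut x≢v) (∈-allBut y≢v) x≢y

shared-part-diagonal : ∀ {n m} {M : Matrix m} {D : Digraph n} {U : Subset n}
  {p : Fin n → Fin m} {b : Bool} → IsMPartitionOn M D U p →
  ∀ {x y} → x ∈ U → y ∈ U → x ≢ y → arc D x y ≡ b → p x ≡ p y → M (p x) (p x) ≡ b
shared-part-diagonal {M = M} {D} {p = p} {b} part {x} {y} x∈ y∈ x≢y xy≡b same =
  begin
    M (p x) (p x)  ≡⟨ cong (M (p x)) same ⟩
    M (p x) (p y)  ≡⟨ sym (part x y x∈ y∈ x≢y) ⟩
    arc D x y      ≡⟨ xy≡b ⟩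
    b              ∎
  where open ≡-Reasoning

diagonalAvoiding : ∀ {m} → Bool → Matrix m → Subset m
diagonalAvoiding b M = tabulate (λ i → b xor M i i)

∈-diagonalAvoiding : ∀ {m} (b : Bool) (M : Matrix m) {i : Fin m} →
  M i i ≢ b → i ∈ diagonalAvoiding b M
∈-diagonalAvoiding b M {i} Mii≢b = ∈-tabulate _ (xor-of-different b (M i i) Mii≢b)
  where
  xor-of-different : ∀ b c → c ≢ b → b xor c ≡ true
  xor-of-different true  true  c≢b = ⊥-elim (c≢b refl)
  xor-of-different true  false _   = refl
  xor-of-different false true  _   = refl
  xor-of-different false false c≢b = ⊥-elim (c≢b refl)

homogeneous-bound : ∀ {n m} (M : Matrix m) (D : Digraph n) → MinimalObstruction M D →
  (b : Bool) (S : Subset n) → Homogeneous D S →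
  (∀ x y → x ∈ S → y ∈ S → x ≢ y → arc D x y ≡ b) →
  ∣ S ∣ ≤ suc ∣ diagonalAvoiding b M ∣
homogeneous-bound M D (unpartitionable , deletable) b S homogeneous uniform =
  bound-by-deletions S _ deletion-bound
  where
  deletion-bound : ∀ v → v ∈ S → ∣ S - v ∣ ≤ ∣ diagonalAvoiding b M ∣
  deletion-bound v v∈S with deletable v
  ... | p , part = injection-size (S - v) _ p
                     (λ x x∈ → ∈-diagonalAvoiding b M (avoids x∈))
                     separates
    where
    -- a survivor in a part with diagonal b would let v join its twin's part
    avoids : ∀ {x} → x ∈ S - v → M (p x) (p x) ≢ b
    avoids {x} x∈ Mb = unpartitionable (p ∘ merge v x ,
        extend (trans (uniform x v x∈S v∈S x≢v) (sym Mb))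
               (trans (uniform v x v∈S x∈S (≢-sym x≢v)) (sym Mb)))
      where
      x∈S : x ∈ S
      x∈S = p─q⊆p S _ x∈
      x≢v : x ≢ v
      x≢v = ∈p-y⇒≢y S x∈
      open TwinExtension M D (homogeneous x v x∈S v∈S x≢v) p part using (extend)
    separates : ∀ x y → x ∈ S - v → y ∈ S - v → p x ≡ p y → x ≡ y
    separates x y x∈ y∈ same with x ≟ y
    ... | yes x≡y = x≡y
    ... | no  x≢y = ⊥-elim (avoids x∈ (shared-part-diagonal {M = M} {D} part
                      (∈-allBut (∈p-y⇒≢y S x∈)) (∈-allBut (∈p-y⇒≢y S y∈)) x≢y
                      (uniform x y (p─q⊆p S _ x∈) (p─q⊆p S _ y∈) x≢y) same))

-- For b = true (strong cliques) #{i : M i i ≠ b} is k, and for b = false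
-- (independent sets) it is ℓ.
lemma6 : ∀ {n m} (M : Matrix m) (D : Digraph n) → MinimalObstruction M D →
    (∀ (S : Subset n) → Homogeneous D S → StrongClique D S → ∣ S ∣ ≤ suc (numDiagZero M))
    × (∀ (S : Subset n) → Homogeneous D S → Independent D S → ∣ S ∣ ≤ suc (numDiagOne M))
lemma6 M D obstruction = bound true , bound false
  where
  bound : ∀ b S → Homogeneous D S → (∀ x y → x ∈ S → y ∈ S → x ≢ y → arc D x y ≡ b) →
    ∣ S ∣ ≤ suc (count (λ i → T? (b xor M i i)) (tabulate id))
  bound b S homogeneous uniform =
    subst (λ k → ∣ S ∣ ≤ suc k) (∣tabulate∣≡count id (λ i → b xor M i i))
      (homogeneous-bound M D obstruction b S homogeneous uniform)
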